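{- Let $k\geq 3$. Every monotone-forcing subset of $S_k$ contains $B_k$.
   Context: $S_k$ is the set of permutations of $\{1,\dots,k\}$ in one-line notation; $\operatorname{id}_n=12\cdots n$ and $\operatorname{id}_n^r=n\cdots 21$. For $\pi$, the complement is $\pi^c(i)=n+1-\pi(i)$. Pattern containment/avoidance is classical: $\pi$ contains $p\in S_k$ if some subsequence of $\pi$ of length $k$ is order-isomorphic to $p$. For $X\subseteq S_k$, $\operatorname{Av}_n(X)$ is the set of $\pi\in S_n$ avoiding every pattern in $X$. For $k\geq 3$ define $p_k=12\cdots(k-2)\,k\,(k-1)$, $q_k=1\,k\,(k-1)\cdots 2$, $r_k=2\,1\,3\,4\cdots k$, $s_k=2\,3\cdots k\,1$, and $B_k=\{p_k,q_k,r_k,s_k,p_k^c,q_k^c,r_k^c,s_k^c\}$. A set $X\subseteq S_k$ is monotone forcing if there exists $N$ such that $\operatorname{Av}_n(X)=\{\operatorname{id}_n,\operatorname{id}_n^r\}$ for all $n\geq N$. -}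

module Defs where

open import Data.Nat using (ℕ; zero; suc; _≤_)
open import Data.Fin using (Fin; zero; suc; _<_; opposite; fromℕ; inject₁)
open import Data.Vec using (Vec; []; _∷_; _∷ʳ_; lookup; tabulate; map)
open import Data.List using (List; []; _∷_)
open import Data.List.Membership.Propositional using (_∈_)
open import Data.Product using (∃; _×_)
open import Data.Sum using (_⊎_)
open import Relation.Nullary using (¬_)
open import Relation.Binary.PropositionalEquality using (_≡_)
open import Function.Bundles using (_⇔_)

-- One-line notation with values 0-indexed: a word of length n over Fin n.
Word : ℕ → Set
Word n = Vec (Fin n) n

-- The word is a permutation of {0,…,n-1} (injective, hence bijective on Fin n).
IsPerm : ∀ {n} → Word n → Set
IsPerm {n} w = ∀ (i j : Fin n) → lookup w i ≡ lookup w j → i ≡ j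

idP : ∀ n → Word n
idP n = tabulate (λ i → i)

revP : ∀ n → Word n
revP n = tabulate opposite

-- complement π^c(i) = n+1-π(i)  (0-indexed: n-1-π(i))
comp : ∀ {n} → Word n → Word n
comp = map opposite

Contains : ∀ {n k} → Word n → Word k → Set
Contains {n} {k} π p =
  ∃ λ (e : Fin k → Fin n) →
    (∀ a b → a < b → e a < e b) ×
    (∀ a b → (lookup p a < lookup p b) ⇔ (lookup π (e a) < lookup π (e b)))

Avoids : ∀ {n k} → Word n → List (Word k) → Set
Avoids π X = ∀ p → p ∈ X → ¬ Contains π p

MonotoneForcing : ∀ {k} → List (Word k) → Set
MonotoneForcing X =
  ∃ λ (N : ℕ) → ∀ n → N ≤ n → ∀ (π : Word n) → IsPerm π →
    (Avoids π X ⇔ (π ≡ idP n ⊎ π ≡ revP n))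

-- The patterns, for k = n+2 (used with n ≥ 1, i.e. k ≥ 3), 0-indexed values.
-- p_k = 1 2 … (k-2) k (k-1)
pP : ∀ n → Word (suc (suc n))
pP n = (tabulate (λ i → inject₁ (inject₁ i)) ∷ʳ fromℕ (suc n)) ∷ʳ inject₁ (fromℕ n)

-- q_k = 1 k (k-1) … 2
qP : ∀ n → Word (suc (suc n))
qP n = zero ∷ tabulate (λ j → suc (opposite j))

-- r_k = 2 1 3 4 … k
rP : ∀ n → Word (suc (suc n))
rP n = suc zero ∷ zero ∷ tabulate (λ i → suc (suc i))

-- s_k = 2 3 … k 1
sP : ∀ n → Word (suc (suc n))
sP n = tabulate (λ i → suc i) ∷ʳ zero

B : ∀ n → List (Word (suc (suc n)))
B n = pP n ∷ qP n ∷ rP n ∷ sP n ∷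
      comp (pP n) ∷ comp (qP n) ∷ comp (rP n) ∷ comp (sP n) ∷ []

{-# OPTIONS --safe #-}
-- Suppose b ∈ B_k and there are arbitrarily long non-monotone permutations π
-- each of whose length-k subsequences is increasing, decreasing or
-- order-isomorphic to b. If b ∉ X, such a π avoids X, because id and id^r do
-- and a pattern order-isomorphic to b is b itself; once |π| ≥ N this
-- contradicts monotone forcing. For r_k and q_k take π = r_n and π = q_n: a
-- k-subsequence of r_n is increasing unless it uses both of the first two
-- positions, and then it is a copy of r_k; one of q_n is decreasing unless it
-- uses the first position, and then it is a copy of q_k. Reversal and
-- complement preserve all of this, and p = (r^r)^c and s = q^r, which gives
-- the remaining six patterns.
module Submission where

open import Defs
open import Data.Nat using (ℕ; zero; suc; z≤n; s≤s; _≤_; _<_)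
import Data.Nat as ℕ
import Data.Nat.Properties as ℕP
open import Data.Fin as F using (Fin; zero; suc; toℕ; fromℕ; inject₁; opposite; punchOut)
open import Data.Fin.Properties
  using (toℕ-injective; toℕ-inject₁; toℕ<n; opposite-prop; opposite-involutive; any?;
         punchOut-injective; <⇒notInjective)
open import Data.Vec using (Vec; []; _∷_; _∷ʳ_; lookup; tabulate)
open import Data.Vec.Properties using (lookup∘tabulate; lookup-map; ≡-dec)
open import Data.Vec.Relation.Binary.Pointwise.Extensional using (ext; Pointwise-≡⇒≡)
open import Data.List using (List)
open import Data.List.Relation.Unary.All as All using (All; []; _∷_)
open import Data.List.Membership.Propositional using (_∈_)
import Data.List.Membership.DecPropositional as DecMembership
open import Data.Product using (∃; Σ; _×_; _,_; proj₁; proj₂)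
open import Data.Sum using (_⊎_; inj₁; inj₂; [_,_])
open import Data.Empty using (⊥; ⊥-elim)
open import Function using (_∘_)
open import Function.Bundles using (_⇔_; mk⇔; Equivalence)
open import Function.Construct.Composition using (_⇔-∘_)
open import Function.Construct.Symmetry using (⇔-sym)
open import Relation.Nullary using (¬_; yes; no; contradiction)
open import Relation.Nullary.Decidable using (_×-dec_)
open import Relation.Binary using (tri<; tri≈; tri>)
open import Relation.Binary.PropositionalEquality
  using (_≡_; _≗_; refl; sym; trans; cong; subst; subst₂; module ≡-Reasoning)

open Equivalence using (to; from)

SameOrder : ∀ {A : Set} → (A → ℕ) → (A → ℕ) → Set
SameOrder f g = ∀ a c → (f a < f c) ⇔ (g a < g c)

OppositeOrder : ∀ {A : Set} → (A → ℕ) → (A → ℕ) → Set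
OppositeOrder f g = ∀ a c → (f a < f c) ⇔ (g c < g a)

private
  variable
    A : Set
    f g h : A → ℕ

same-sym : SameOrder f g → SameOrder g f
same-sym fg a c = ⇔-sym (fg a c)

same-trans : SameOrder f g → SameOrder g h → SameOrder f h
same-trans fg gh a c = gh a c ⇔-∘ fg a c

opposite-sym : OppositeOrder f g → OppositeOrder g f
opposite-sym fg a c = ⇔-sym (fg c a)

same-opposite : SameOrder f g → OppositeOrder g h → OppositeOrder f h
same-opposite fg gh a c = gh a c ⇔-∘ fg a c

opposite-same : OppositeOrder f g → SameOrder g h → OppositeOrder f h
opposite-same fg gh a c = gh c a ⇔-∘ fg a c

opposite-opposite : OppositeOrder f g → OppositeOrder g h → SameOrder f h
opposite-opposite fg gh a c = gh c a ⇔-∘ fg a c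

≗⇒same : f ≗ g → SameOrder f g
≗⇒same f≗g a c =
  mk⇔ (subst₂ _<_ (f≗g a) (f≗g c)) (subst₂ _<_ (sym (f≗g a)) (sym (f≗g c)))

preserves⇒sameOrder : (∀ {a c} → g a ≡ g c → a ≡ c) →
                      (∀ a c → g a < g c → f a < f c) → SameOrder f g
preserves⇒sameOrder {g = g} {f = f} g-injective preserves a c = mk⇔ reflects (preserves a c)
  where
  reflects : f a < f c → g a < g c
  reflects fa<fc with ℕP.<-cmp (g a) (g c)
  ... | tri< ga<gc _ _ = ga<gc
  ... | tri≈ _ ga≡gc _ = contradiction fa<fc (ℕP.<-irrefl (cong f (g-injective ga≡gc)))
  ... | tri> _ _ gc<ga = contradiction (preserves c a gc<ga) (ℕP.<-asym fa<fc)

opposite-reverses : ∀ {n} → OppositeOrder (toℕ ∘ opposite {n}) toℕ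
opposite-reverses {n} a c rewrite opposite-prop a | opposite-prop c =
  mk⇔ (λ lt → ℕ.s<s⁻¹ (ℕP.∸-cancelʳ-< {o = n} lt))
      (λ lt → ℕP.∸-monoʳ-< (s≤s lt) (toℕ<n a))

opposite-injective : ∀ {n} {i j : Fin n} → opposite i ≡ opposite j → i ≡ j
opposite-injective {i = i} {j} eq =
  trans (sym (opposite-involutive i)) (trans (cong opposite eq) (opposite-involutive j))

opposite-fromℕ : ∀ n → opposite (fromℕ n) ≡ zero
opposite-fromℕ zero    = refl
opposite-fromℕ (suc n) = cong inject₁ (opposite-fromℕ n)

opposite-inject₁ : ∀ {n} (i : Fin n) → opposite (inject₁ i) ≡ suc (opposite i)
opposite-inject₁ zero    = refl
opposite-inject₁ (suc i) = cong inject₁ (opposite-inject₁ i)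

data LastView : ∀ {n} → Fin (suc n) → Set where
  last   : ∀ {n} → LastView (fromℕ n)
  inject : ∀ {n} (i : Fin n) → LastView (inject₁ i)

lastView : ∀ {n} (i : Fin (suc n)) → LastView i
lastView {zero}  zero    = last
lastView {suc n} zero    = inject zero
lastView {suc n} (suc i) with lastView i
... | last     = last
... | inject j = inject (suc j)

lookup-∷ʳ-last : ∀ {n} (xs : Vec A n) {y : A} → lookup (xs ∷ʳ y) (fromℕ n) ≡ y
lookup-∷ʳ-last []       = refl
lookup-∷ʳ-last (_ ∷ xs) = lookup-∷ʳ-last xs

lookup-∷ʳ-inject₁ : ∀ {n} (xs : Vec A n) {y : A} (i : Fin n) →
                    lookup (xs ∷ʳ y) (inject₁ i) ≡ lookup xs i
lookup-∷ʳ-inject₁ (_ ∷ xs) zero    = refl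
lookup-∷ʳ-inject₁ (_ ∷ xs) (suc i) = lookup-∷ʳ-inject₁ xs i

StrictlyIncreasing : ∀ {k n} → (Fin k → Fin n) → Set
StrictlyIncreasing e = ∀ a c → a F.< c → e a F.< e c

StrictlyDecreasing : ∀ {k n} → (Fin k → Fin n) → Set
StrictlyDecreasing e = ∀ a c → a F.< c → e c F.< e a

increasing⇒sameOrder : ∀ {k n} {e : Fin k → Fin n} → StrictlyIncreasing e → SameOrder (toℕ ∘ e) toℕ
increasing⇒sameOrder = preserves⇒sameOrder toℕ-injective

increasing⇒≥ : ∀ {k n} {e : Fin k → Fin n} → StrictlyIncreasing e → ∀ a → toℕ a ≤ toℕ (e a)
increasing⇒≥ increasing zero = z≤n
increasing⇒≥ {e = e} increasing (suc a) =
  ℕP.≤-<-trans (increasing⇒≥ increasing∘inject₁ a) (increasing (inject₁ a) (suc a) inject₁<suc)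
  where
  increasing∘inject₁ : StrictlyIncreasing (e ∘ inject₁)
  increasing∘inject₁ a c a<c = increasing (inject₁ a) (inject₁ c)
    (subst₂ _<_ (sym (toℕ-inject₁ a)) (sym (toℕ-inject₁ c)) a<c)
  inject₁<suc : inject₁ a F.< suc a
  inject₁<suc = s≤s (ℕP.≤-reflexive (toℕ-inject₁ a))

increasing⇒suc-positive : ∀ {k n} {e : Fin (suc k) → Fin n} → StrictlyIncreasing e →
                          ∀ a → 0 < toℕ (e (suc a))
increasing⇒suc-positive increasing a = ℕP.<-≤-trans (s≤s z≤n) (increasing⇒≥ increasing (suc a))

mirror : ∀ {k n} → (Fin k → Fin n) → Fin k → Fin n
mirror e = opposite ∘ e ∘ opposite

mirror-increasing : ∀ {k n} {e : Fin k → Fin n} → StrictlyIncreasing e → StrictlyIncreasing (mirror e)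
mirror-increasing {e = e} increasing a c a<c =
  from (opposite-reverses (e (opposite a)) (e (opposite c)))
       (increasing (opposite c) (opposite a) (from (opposite-reverses c a) a<c))

val : ∀ {n} → Word n → Fin n → ℕ
val w = toℕ ∘ lookup w

involution⇒IsPerm : ∀ {n} {w : Word n} → (∀ i → lookup w (lookup w i) ≡ i) → IsPerm w
involution⇒IsPerm {w = w} involution i j eq =
  trans (sym (involution i)) (trans (cong (lookup w) eq) (involution j))

IsPerm⇒surjective : ∀ {k} {w : Word k} → IsPerm w → ∀ v → ∃ λ i → lookup w i ≡ v
IsPerm⇒surjective {suc k} {w} w-perm v with any? (λ i → lookup w i F.≟ v)
... | yes hit  = hit
... | no  miss = contradiction
  (λ {i} {j} eq → w-perm i j (punchOut-injective (misses i) (misses j) eq))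
  (<⇒notInjective {f = punchOut ∘ misses} (ℕP.n<1+n k))
  where
  misses : ∀ i → v ≡ lookup w i → ⊥
  misses i v≡wi = miss (i , sym v≡wi)

order-preserving⇒≤ : ∀ {k} {w v : Word k} → IsPerm w →
                     (∀ a c → val w a < val w c → val v a < val v c) → ∀ a → val w a ≤ val v a
order-preserving⇒≤ {k} {w} {v} w-perm preserves a =
  subst (λ x → val w a ≤ val v x) (w⁻¹∘w a) (increasing⇒≥ v∘w⁻¹-increasing (lookup w a))
  where
  w⁻¹ : Fin k → Fin k
  w⁻¹ t = proj₁ (IsPerm⇒surjective {w = w} w-perm t)
  w∘w⁻¹ : ∀ t → lookup w (w⁻¹ t) ≡ t
  w∘w⁻¹ t = proj₂ (IsPerm⇒surjective {w = w} w-perm t)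
  w⁻¹∘w : ∀ a → w⁻¹ (lookup w a) ≡ a
  w⁻¹∘w a = w-perm _ _ (w∘w⁻¹ (lookup w a))
  v∘w⁻¹-increasing : StrictlyIncreasing (lookup v ∘ w⁻¹)
  v∘w⁻¹-increasing t u t<u =
    preserves _ _ (subst₂ F._<_ (sym (w∘w⁻¹ t)) (sym (w∘w⁻¹ u)) t<u)

sameOrder⇒≡ : ∀ {k} {w v : Word k} → IsPerm w → IsPerm v → SameOrder (val w) (val v) → w ≡ v
sameOrder⇒≡ {w = w} {v} w-perm v-perm w≈v = Pointwise-≡⇒≡ (ext λ a →
  toℕ-injective (ℕP.≤-antisym
    (order-preserving⇒≤ {w = w} {v} w-perm (λ a c → to (w≈v a c)) a)
    (order-preserving⇒≤ {w = v} {w} v-perm (λ a c → from (w≈v a c)) a)))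

module _ {n : ℕ} where

  lookup-idP : ∀ i → lookup (idP n) i ≡ i
  lookup-idP = lookup∘tabulate (λ i → i)

  lookup-revP : ∀ i → lookup (revP n) i ≡ opposite i
  lookup-revP = lookup∘tabulate opposite

  idP-isPerm : IsPerm (idP n)
  idP-isPerm = involution⇒IsPerm {w = idP n} λ i →
    trans (lookup-idP (lookup (idP n) i)) (lookup-idP i)

  revP-isPerm : IsPerm (revP n)
  revP-isPerm = involution⇒IsPerm {w = revP n} λ i →
    trans (lookup-revP (lookup (revP n) i)) (trans (cong opposite (lookup-revP i)) (opposite-involutive i))

  idP-increasing : StrictlyIncreasing (lookup (idP n))
  idP-increasing a c = subst₂ F._<_ (sym (lookup-idP a)) (sym (lookup-idP c))

  revP-decreasing : StrictlyDecreasing (lookup (revP n))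
  revP-decreasing a c a<c =
    subst₂ F._<_ (sym (lookup-revP c)) (sym (lookup-revP a)) (from (opposite-reverses c a) a<c)

  module _ {k} {e : Fin k → Fin n} (increasing : StrictlyIncreasing e) where

    idP-subsequence : SameOrder (val (idP n) ∘ e) toℕ
    idP-subsequence =
      same-trans (≗⇒same (cong toℕ ∘ lookup-idP ∘ e)) (increasing⇒sameOrder increasing)

    revP-subsequence : OppositeOrder (val (revP n) ∘ e) toℕ
    revP-subsequence = same-opposite (≗⇒same (cong toℕ ∘ lookup-revP ∘ e))
      (opposite-same (λ a c → opposite-reverses (e a) (e c)) (increasing⇒sameOrder increasing))

MonotoneOrPattern : ∀ {k n} → Word k → Word n → (Fin k → Fin n) → Set
MonotoneOrPattern b π e =
  SameOrder (val π ∘ e) toℕ ⊎ OppositeOrder (val π ∘ e) toℕ ⊎ SameOrder (val π ∘ e) (val b)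

record Witness {k n} (b : Word k) (π : Word n) : Set where
  field
    isPerm        : IsPerm π
    notIncreasing : ¬ StrictlyIncreasing (lookup π)
    notDecreasing : ¬ StrictlyDecreasing (lookup π)
    subsequences  : ∀ e → StrictlyIncreasing e → MonotoneOrPattern b π e

witnesses⇒∈ : ∀ {k} {X : List (Word k)} {b : Word k} → All IsPerm X → MonotoneForcing X → IsPerm b →
              (∀ N → ∃ λ n → N ≤ n × Σ (Word n) (Witness b)) → b ∈ X
witnesses⇒∈ {X = X} {b} perms (N , forcing) b-perm witnesses
  with witnesses N | DecMembership._∈?_ (≡-dec F._≟_) b X
... | _ | yes b∈X = b∈X
... | n , N≤n , π , witness | no b∉X =
  ⊥-elim ([ notIdP , notRevP ] (to (forcing n N≤n π isPerm) avoids))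
  where
  open Witness witness
  avoids : Avoids π X
  avoids p p∈X (e , increasing , p≈πe) with subsequences e increasing
  ... | inj₁ πe≈id = from (forcing n N≤n (idP n) idP-isPerm) (inj₁ refl) p p∈X
    (e , increasing , same-trans p≈πe (same-trans πe≈id (same-sym (idP-subsequence increasing))))
  ... | inj₂ (inj₁ πe≈rev) = from (forcing n N≤n (revP n) revP-isPerm) (inj₂ refl) p p∈X
    (e , increasing , same-trans p≈πe
      (opposite-opposite πe≈rev (opposite-sym (revP-subsequence increasing))))
  ... | inj₂ (inj₂ πe≈b) = b∉X (subst (_∈ X)
    (sameOrder⇒≡ {w = p} {b} (All.lookup perms p∈X) b-perm (same-trans p≈πe πe≈b)) p∈X)
  notIdP : ¬ π ≡ idP n
  notIdP π≡id = notIncreasing (subst (λ w → StrictlyIncreasing (lookup w)) (sym π≡id) idP-increasing)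
  notRevP : ¬ π ≡ revP n
  notRevP π≡rev = notDecreasing (subst (λ w → StrictlyDecreasing (lookup w)) (sym π≡rev) revP-decreasing)

-- w 0 has length 2, so it is monotone; the witnesses are the w (suc n).
WitnessFamily : (∀ n → Word (suc (suc n))) → Set
WitnessFamily w = ∀ m n → Witness (w m) (w (suc n))

family⇒∈ : ∀ {m} {X : List (Word (suc (suc (suc m))))} {w} → All IsPerm X → MonotoneForcing X →
           WitnessFamily w → w (suc m) ∈ X
family⇒∈ {m} {w = w} perms forcing family = witnesses⇒∈ perms forcing (Witness.isPerm (family m m))
  λ N → suc (suc (suc N)) , ℕP.m≤n+m N 3 , w (suc N) , family (suc m) N

family-cong : ∀ {v w} → (∀ n → v n ≡ w n) → WitnessFamily w → WitnessFamily v
family-cong v≡w family m n = subst₂ Witness (sym (v≡w m)) (sym (v≡w (suc n))) (family m n)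

lookup-comp : ∀ {n} (w : Word n) i → lookup (comp w) i ≡ opposite (lookup w i)
lookup-comp w i = lookup-map i opposite w

comp-opposite : ∀ {n} (w : Word n) → OppositeOrder (val (comp w)) (val w)
comp-opposite w = same-opposite (≗⇒same (cong toℕ ∘ lookup-comp w))
                                (λ a c → opposite-reverses (lookup w a) (lookup w c))

complement-witness : ∀ {k n} {b : Word k} {π : Word n} → Witness b π → Witness (comp b) (comp π)
complement-witness {k} {n} {b} {π} witness = record
  { isPerm        = λ i j eq → isPerm i j (opposite-injective
                      (trans (sym (lookup-comp π i)) (trans eq (lookup-comp π j))))
  ; notIncreasing = λ increasing → notDecreasing λ a c a<c →
                      to (comp-opposite π a c) (increasing a c a<c)
  ; notDecreasing = λ decreasing → notIncreasing λ a c a<c →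
                      to (comp-opposite π c a) (decreasing a c a<c)
  ; subsequences  = subsequences′
  }
  where
  open Witness witness
  πe-reversed : ∀ (e : Fin k → Fin n) → OppositeOrder (val (comp π) ∘ e) (val π ∘ e)
  πe-reversed e a c = comp-opposite π (e a) (e c)
  subsequences′ : ∀ e → StrictlyIncreasing e → MonotoneOrPattern (comp b) (comp π) e
  subsequences′ e increasing with subsequences e increasing
  ... | inj₁ πe≈id         = inj₂ (inj₁ (opposite-same (πe-reversed e) πe≈id))
  ... | inj₂ (inj₁ πe≈rev) = inj₁ (opposite-opposite (πe-reversed e) πe≈rev)
  ... | inj₂ (inj₂ πe≈b)   = inj₂ (inj₂
    (opposite-opposite (opposite-same (πe-reversed e) πe≈b) (opposite-sym (comp-opposite b))))

complement-family : ∀ {w} → WitnessFamily w → WitnessFamily (λ n → comp (w n))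
complement-family family m n = complement-witness (family m n)

reverse : ∀ {n} → Word n → Word n
reverse w = tabulate (lookup w ∘ opposite)

lookup-reverse : ∀ {n} (w : Word n) i → lookup (reverse w) i ≡ lookup w (opposite i)
lookup-reverse w = lookup∘tabulate (lookup w ∘ opposite)

lookup-reverse-opposite : ∀ {n} (w : Word n) i → lookup (reverse w) (opposite i) ≡ lookup w i
lookup-reverse-opposite w i =
  trans (lookup-reverse w (opposite i)) (cong (lookup w) (opposite-involutive i))

reverse-witness : ∀ {k n} {b : Word k} {π : Word n} → Witness b π → Witness (reverse b) (reverse π)
reverse-witness {k} {n} {b} {π} witness = record
  { isPerm        = λ i j eq → opposite-injective (isPerm _ _
                      (trans (sym (lookup-reverse π i)) (trans eq (lookup-reverse π j))))
  ; notIncreasing = λ increasing → notDecreasing λ a c a<c → subst₂ F._<_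
                      (lookup-reverse-opposite π c) (lookup-reverse-opposite π a)
                      (increasing (opposite c) (opposite a) (from (opposite-reverses c a) a<c))
  ; notDecreasing = λ decreasing → notIncreasing λ a c a<c → subst₂ F._<_
                      (lookup-reverse-opposite π a) (lookup-reverse-opposite π c)
                      (decreasing (opposite c) (opposite a) (from (opposite-reverses c a) a<c))
  ; subsequences  = subsequences′
  }
  where
  open Witness witness
  reindex : ∀ (e : Fin k → Fin n) → SameOrder (val (reverse π) ∘ e) (val π ∘ mirror e ∘ opposite)
  reindex e = ≗⇒same λ a → cong toℕ (trans (lookup-reverse π (e a))
                (cong (lookup π ∘ opposite ∘ e) (sym (opposite-involutive a))))
  subsequences′ : ∀ e → StrictlyIncreasing e → MonotoneOrPattern (reverse b) (reverse π) e
  subsequences′ e increasing with subsequences (mirror e) (mirror-increasing increasing)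
  ... | inj₁ πe≈id = inj₂ (inj₁ (same-opposite
    (same-trans (reindex e) λ a c → πe≈id (opposite a) (opposite c)) opposite-reverses))
  ... | inj₂ (inj₁ πe≈rev) = inj₁ (opposite-opposite
    (same-opposite (reindex e) λ a c → πe≈rev (opposite a) (opposite c)) opposite-reverses)
  ... | inj₂ (inj₂ πe≈b) = inj₂ (inj₂ (same-trans (reindex e)
    (same-trans (λ a c → πe≈b (opposite a) (opposite c))
                (same-sym (≗⇒same (cong toℕ ∘ lookup-reverse b))))))

reverse-family : ∀ {w} → WitnessFamily w → WitnessFamily (λ n → reverse (w n))
reverse-family family m n = reverse-witness (family m n)

lookup-rP-suc-suc : ∀ {n} (j : Fin n) → lookup (rP n) (suc (suc j)) ≡ suc (suc j)
lookup-rP-suc-suc = lookup∘tabulate (λ i → suc (suc i))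

rP-involution : ∀ {n} i → lookup (rP n) (lookup (rP n) i) ≡ i
rP-involution zero              = refl
rP-involution (suc zero)        = refl
rP-involution {n} (suc (suc j)) =
  trans (cong (lookup (rP n)) (lookup-rP-suc-suc j)) (lookup-rP-suc-suc j)

rP-fixes : ∀ {n} (x : Fin (suc (suc n))) → 2 ≤ toℕ x → lookup (rP n) x ≡ x
rP-fixes (suc (suc j)) _ = lookup-rP-suc-suc j
rP-fixes (suc zero) (s≤s ())

rP-ascent : ∀ {n} {x y : Fin (suc (suc n))} → x F.< y → ¬ (x ≡ zero × y ≡ suc zero) →
            lookup (rP n) x F.< lookup (rP n) y
rP-ascent {x = zero}        {suc zero}    _ not01 = ⊥-elim (not01 (refl , refl))
rP-ascent {x = zero}        {suc (suc j)} _ _     =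
  subst (1 <_) (sym (cong toℕ (lookup-rP-suc-suc j))) (s≤s (s≤s z≤n))
rP-ascent {x = suc zero}    {suc (suc j)} _ _     =
  subst (0 <_) (sym (cong toℕ (lookup-rP-suc-suc j))) (s≤s z≤n)
rP-ascent {x = suc (suc i)} {suc (suc j)} i<j _   =
  subst₂ F._<_ (sym (lookup-rP-suc-suc i)) (sym (lookup-rP-suc-suc j)) i<j
rP-ascent {x = suc zero}    {suc zero}    (s≤s ())
rP-ascent {x = suc (suc _)} {suc zero}    (s≤s ())

rP-subsequences : ∀ m n e → StrictlyIncreasing e → MonotoneOrPattern (rP m) (rP n) e
rP-subsequences m n e increasing with (e zero F.≟ zero) ×-dec (e (suc zero) F.≟ suc zero)
... | yes (e0 , e1) = inj₂ (inj₂ (same-trans (≗⇒same (cong toℕ ∘ commutes))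
                        λ a c → increasing⇒sameOrder increasing (lookup (rP m) a) (lookup (rP m) c)))
  where
  commutes : ∀ a → lookup (rP n) (e a) ≡ e (lookup (rP m) a)
  commutes zero          = trans (cong (lookup (rP n)) e0) (sym e1)
  commutes (suc zero)    = trans (cong (lookup (rP n)) e1) (sym e0)
  commutes (suc (suc j)) = trans (rP-fixes (e (suc (suc j))) 2≤e) (cong e (sym (lookup-rP-suc-suc j)))
    where
    2≤e : 2 ≤ toℕ (e (suc (suc j)))
    2≤e = subst (λ x → toℕ x < toℕ (e (suc (suc j)))) e1
                (increasing (suc zero) (suc (suc j)) (s≤s (s≤s z≤n)))
... | no not01 = inj₁ (preserves⇒sameOrder toℕ-injective λ a c a<c →
                   rP-ascent (increasing a c a<c)
                             λ (ea≡0 , ec≡1) → not01 (start-fixed a c a<c ea≡0 ec≡1))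
  where
  start-fixed : ∀ a c → a F.< c → e a ≡ zero → e c ≡ suc zero →
                e zero ≡ zero × e (suc zero) ≡ suc zero
  start-fixed zero (suc zero) _ ea≡0 ec≡1 = ea≡0 , ec≡1
  start-fixed zero (suc (suc c)) _ _ ec≡1
    with subst (λ x → suc (suc (toℕ c)) ≤ toℕ x) ec≡1 (increasing⇒≥ increasing (suc (suc c)))
  ... | s≤s ()
  start-fixed (suc a) _ _ ea≡0 _
    with subst (λ x → 0 < toℕ x) ea≡0 (increasing⇒suc-positive increasing a)
  ... | ()

rP-family : WitnessFamily rP
rP-family m n = record
  { isPerm        = involution⇒IsPerm {w = rP (suc n)} rP-involution
  ; notIncreasing = λ increasing → ℕP.n≮0 (increasing zero (suc zero) (s≤s z≤n))
  ; notDecreasing = λ decreasing → ℕP.n≮0 (decreasing (suc zero) (suc (suc zero)) (s≤s (s≤s z≤n)))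
  ; subsequences  = rP-subsequences m (suc n)
  }

lookup-qP-suc : ∀ {n} (j : Fin (suc n)) → lookup (qP n) (suc j) ≡ suc (opposite j)
lookup-qP-suc = lookup∘tabulate (λ j → suc (opposite j))

qP-involution : ∀ {n} i → lookup (qP n) (lookup (qP n) i) ≡ i
qP-involution zero        = refl
qP-involution {n} (suc j) = begin
  lookup (qP n) (lookup (qP n) (suc j)) ≡⟨ cong (lookup (qP n)) (lookup-qP-suc j) ⟩
  lookup (qP n) (suc (opposite j))      ≡⟨ lookup-qP-suc (opposite j) ⟩
  suc (opposite (opposite j))           ≡⟨ cong suc (opposite-involutive j) ⟩
  suc j                                 ∎
  where open ≡-Reasoning

qP-suc-reverses : ∀ {n} → OppositeOrder (val (qP n) ∘ suc) toℕ
qP-suc-reverses a c =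
  opposite-reverses a c ⇔-∘ (mk⇔ ℕ.s<s⁻¹ ℕ.s<s ⇔-∘ ≗⇒same (cong toℕ ∘ lookup-qP-suc) a c)

qP-positive : ∀ {n} (x : Fin (suc (suc n))) → 0 < toℕ x → 0 < val (qP n) x
qP-positive (suc j) _ = subst (0 <_) (sym (cong toℕ (lookup-qP-suc j))) (s≤s z≤n)

qP-antitone : ∀ {n} {x y : Fin (suc (suc n))} → 0 < toℕ x → x F.< y → val (qP n) y < val (qP n) x
qP-antitone {x = suc i} {suc j} _ (s≤s i<j) = from (qP-suc-reverses j i) i<j

qP-subsequences : ∀ m n e → StrictlyIncreasing e → MonotoneOrPattern (qP m) (qP n) e
qP-subsequences m n e increasing with e zero F.≟ zero
... | yes e0 = inj₂ (inj₂ (preserves⇒sameOrder (λ eq → qP-isPerm _ _ (toℕ-injective eq)) preserves))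
  where
  qP-isPerm : IsPerm (qP m)
  qP-isPerm = involution⇒IsPerm {w = qP m} qP-involution
  preserves : ∀ a c → val (qP m) a < val (qP m) c → val (qP n) (e a) < val (qP n) (e c)
  preserves (suc a) zero    lt = contradiction lt ℕP.n≮0
  preserves zero    (suc c) _  = subst (λ x → val (qP n) x < val (qP n) (e (suc c))) (sym e0)
    (qP-positive (e (suc c)) (increasing⇒suc-positive increasing c))
  preserves (suc a) (suc c) lt = qP-antitone (increasing⇒suc-positive increasing c)
    (increasing (suc c) (suc a) (s≤s (to (qP-suc-reverses a c) lt)))
... | no e0≢0 = inj₂ (inj₁ (same-opposite
                  (preserves⇒sameOrder (opposite-injective ∘ toℕ-injective) preserves) opposite-reverses))
  where
  positive : ∀ a → 0 < toℕ (e a)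
  positive zero    = ℕP.n≢0⇒n>0 (e0≢0 ∘ toℕ-injective)
  positive (suc a) = increasing⇒suc-positive increasing a
  preserves : ∀ a c → toℕ (opposite a) < toℕ (opposite c) → val (qP n) (e a) < val (qP n) (e c)
  preserves a c lt = qP-antitone (positive c) (increasing c a (to (opposite-reverses a c) lt))

qP-family : WitnessFamily qP
qP-family m n = record
  { isPerm        = involution⇒IsPerm {w = qP (suc n)} qP-involution
  ; notIncreasing = λ increasing → ℕP.<-asym
                      (increasing (suc zero) (suc (suc zero)) (s≤s (s≤s z≤n)))
                      (qP-antitone {x = suc zero} {suc (suc zero)} (s≤s z≤n) (s≤s (s≤s z≤n)))
  ; notDecreasing = λ decreasing → ℕP.n≮0 (decreasing zero (suc zero) (s≤s z≤n))
  ; subsequences  = qP-subsequences m (suc n)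
  }

sP≡reverse-qP : ∀ n → sP n ≡ reverse (qP n)
sP≡reverse-qP n = Pointwise-≡⇒≡ (ext λ i → trans (pointwise i) (sym (lookup-reverse (qP n) i)))
  where
  open ≡-Reasoning
  pointwise : ∀ i → lookup (sP n) i ≡ lookup (qP n) (opposite i)
  pointwise i with lastView i
  ... | last = begin
    lookup (sP n) (fromℕ (suc n))             ≡⟨ lookup-∷ʳ-last (tabulate suc) ⟩
    zero                                      ≡⟨ cong (lookup (qP n)) (opposite-fromℕ (suc n)) ⟨
    lookup (qP n) (opposite (fromℕ (suc n)))  ∎
  ... | inject j = begin
    lookup (sP n) (inject₁ j)                 ≡⟨ lookup-∷ʳ-inject₁ (tabulate suc) j ⟩
    lookup (tabulate suc) j                   ≡⟨ lookup∘tabulate suc j ⟩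
    suc j                                     ≡⟨ cong suc (opposite-involutive j) ⟨
    suc (opposite (opposite j))               ≡⟨ lookup-qP-suc (opposite j) ⟨
    lookup (qP n) (suc (opposite j))          ≡⟨ cong (lookup (qP n)) (opposite-inject₁ j) ⟨
    lookup (qP n) (opposite (inject₁ j))      ∎

pP≡comp-reverse-rP : ∀ n → pP n ≡ comp (reverse (rP n))
pP≡comp-reverse-rP n = Pointwise-≡⇒≡ (ext λ i → trans (pointwise i) (sym
  (trans (lookup-comp (reverse (rP n)) i) (cong opposite (lookup-reverse (rP n) i)))))
  where
  open ≡-Reasoning
  initial : Vec (Fin (suc (suc n))) n
  initial = tabulate (λ i → inject₁ (inject₁ i))
  front : Vec (Fin (suc (suc n))) (suc n)
  front = initial ∷ʳ fromℕ (suc n)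
  r : Fin (suc (suc n)) → Fin (suc (suc n))
  r = lookup (rP n)
  pointwise : ∀ i → lookup (pP n) i ≡ opposite (r (opposite i))
  pointwise i with lastView i
  ... | last = begin
    lookup (pP n) (fromℕ (suc n))                  ≡⟨ lookup-∷ʳ-last front ⟩
    opposite (r zero)                              ≡⟨ cong (opposite ∘ r) (opposite-fromℕ (suc n)) ⟨
    opposite (r (opposite (fromℕ (suc n))))        ∎
  ... | inject j with lastView j
  ...   | last = begin
    lookup (pP n) (inject₁ (fromℕ n))              ≡⟨ lookup-∷ʳ-inject₁ front (fromℕ n) ⟩
    lookup front (fromℕ n)                         ≡⟨ lookup-∷ʳ-last initial ⟩
    opposite (r (suc zero))                        ≡⟨ cong (opposite ∘ r ∘ suc) (opposite-fromℕ n) ⟨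
    opposite (r (suc (opposite (fromℕ n))))        ≡⟨ cong (opposite ∘ r) (opposite-inject₁ (fromℕ n)) ⟨
    opposite (r (opposite (inject₁ (fromℕ n))))    ∎
  ...   | inject j′ = begin
    lookup (pP n) (inject₁ (inject₁ j′))           ≡⟨ lookup-∷ʳ-inject₁ front (inject₁ j′) ⟩
    lookup front (inject₁ j′)                      ≡⟨ lookup-∷ʳ-inject₁ initial j′ ⟩
    lookup initial j′                              ≡⟨ lookup∘tabulate (inject₁ ∘ inject₁) j′ ⟩
    inject₁ (inject₁ j′)                           ≡⟨ cong (inject₁ ∘ inject₁) (opposite-involutive j′) ⟨
    opposite (suc (suc (opposite j′)))             ≡⟨ cong opposite (lookup-rP-suc-suc (opposite j′)) ⟨
    opposite (r (suc (suc (opposite j′))))         ≡⟨ cong (opposite ∘ r ∘ suc) (opposite-inject₁ j′) ⟨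
    opposite (r (suc (opposite (inject₁ j′))))     ≡⟨ cong (opposite ∘ r) (opposite-inject₁ (inject₁ j′)) ⟨
    opposite (r (opposite (inject₁ (inject₁ j′)))) ∎

sP-family : WitnessFamily sP
sP-family = family-cong sP≡reverse-qP (reverse-family qP-family)

pP-family : WitnessFamily pP
pP-family = family-cong pP≡comp-reverse-rP (complement-family (reverse-family rP-family))

theorem4p3 : (m : ℕ) (X : List (Word (suc (suc (suc m))))) →
    All IsPerm X → MonotoneForcing X →
    ∀ p → p ∈ B (suc m) → p ∈ X
theorem4p3 m X perms forcing p = All.lookup B⊆X
  where
  member : ∀ {w} → WitnessFamily w → w (suc m) ∈ X
  member = family⇒∈ perms forcing
  B⊆X : All (_∈ X) (B (suc m))
  B⊆X = member pP-family ∷ member qP-family ∷ member rP-family ∷ member sP-family ∷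
        member (complement-family pP-family) ∷ member (complement-family qP-family) ∷
        member (complement-family rP-family) ∷ member (complement-family sP-family) ∷ []
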